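{- Let $T$ be a finite string (e.g. a prefix $S[1,i]$ of a stream), let $\ell^*$ be a natural number, and let $m_1<\dots<m_h$ ($h\ge3$) be the midpoints of a maximal $\ell^*$-run in $T$. Then for every $j\in\{1,\dots,h\}$, $$\ell(m_j)=\begin{cases}\ell(m_1)+(j-1)(m_2-m_1) & j<\frac{h+1}{2},\\ \ell(m_h)+(h-j)(m_2-m_1) & j>\frac{h+1}{2},\end{cases}$$ where $\ell(\cdot)$ is computed in $T$.
   Context: Palindromes are considered in their even form: a string $T$ of length $N$ contains a palindrome of length $\ell$ with midpoint $m$ if $T[m-i+1]=T[m+i]$ for all $i\in\{1,\dots,\ell\}$ (indices within $\{1,\dots,N\}$); $\ell(m)$ is the maximal such $\ell$, and $\ell(z)=0$ for $z\notin\{1,\dots,N\}$. The palindrome at $m$ is an $\ell^*$-palindrome if $\ell(m)\ge\ell^*$. An $\ell^*$-run is a sequence $m_1<\dots<m_h$, $h\ge3$, of consecutive midpoints of $\ell^*$-palindromes (no other $\ell^*$-palindrome midpoint lies between them) with $m_{j+1}-m_j\le\ell^*/2$ for all $j$. It is maximal if $\ell(m_1-(m_2-m_1))<\ell^*$ and $\ell(m_h+(m_2-m_1))<\ell^*$. -}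

module Defs where

open import Data.Nat using (ℕ; zero; suc; _+_; _*_; _∸_; _≤_; _<_)
open import Data.List using (List; []; _∷_; length)
open import Data.Maybe using (Maybe; just; nothing)
open import Data.Product using (_×_)
open import Relation.Binary.PropositionalEquality using (_≡_)
open import Relation.Nullary using (¬_)

-- 1-based character access: at T k = just T[k] for 1 ≤ k ≤ |T|, nothing otherwise.
at : {A : Set} → List A → ℕ → Maybe A
at []       _             = nothing
at (x ∷ xs) zero          = nothing
at (x ∷ xs) (suc zero)    = just x
at (x ∷ xs) (suc (suc k)) = at xs (suc k)

InRange : {A : Set} → List A → ℕ → Set
InRange T z = 1 ≤ z × z ≤ length T

-- T contains an (even) palindrome of length l with midpoint m:
-- for all i ∈ {1,…,l}, the indices m-i+1 and m+i lie in {1,…,N}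
-- and T[m-i+1] = T[m+i].  (suc m ∸ i truncates to 0 ∉ {1..N} if i > m+1.)
PalAt : {A : Set} → List A → ℕ → ℕ → Set
PalAt T m l = ∀ i → 1 ≤ i → i ≤ l →
  InRange T (suc m ∸ i) × InRange T (m + i) × at T (suc m ∸ i) ≡ at T (m + i)

IsPalLen : {A : Set} → List A → (ℕ → ℕ) → Set
IsPalLen T L =
  (∀ m → InRange T m → PalAt T m (L m) × (∀ l → PalAt T m l → l ≤ L m)) ×
  (∀ z → ¬ InRange T z → L z ≡ 0)

IsPalMid : {A : Set} → List A → (ℕ → ℕ) → ℕ → ℕ → Set
IsPalMid T L ℓ* m = InRange T m × ℓ* ≤ L m

IsMaximalRun : {A : Set} → List A → (ℕ → ℕ) → ℕ → ℕ → (ℕ → ℕ) → Set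
IsMaximalRun T L ℓ* h M =
  3 ≤ h ×
  (∀ j → 1 ≤ j → j < h → M j < M (suc j)) ×
  (∀ j → 1 ≤ j → j ≤ h → IsPalMid T L ℓ* (M j)) ×
  (∀ j → 1 ≤ j → j < h → ∀ z → M j < z → z < M (suc j) → ¬ IsPalMid T L ℓ* z) ×
  (∀ j → 1 ≤ j → j < h → 2 * (M (suc j) ∸ M j) ≤ ℓ*) ×
  -- maximality (midpoint M 1 - d < 1 is outside {1..N}; ∸ truncates to 0, also outside)
  L (M 1 ∸ (M 2 ∸ M 1)) < ℓ* ×
  L (M h + (M 2 ∸ M 1)) < ℓ*

-- Palindromes are read as mirror symmetries, so that reflections through midpoints compose
-- additively. If x, c, y are equally spaced at distance
-- g ≤ ℓ(c), reflecting through x, c, y extends the palindrome at c to radius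
-- min(ℓ(x), ℓ(y)) + g, while a palindrome at c of radius ℓ(x) + g + 1 would mirror one of
-- radius ℓ(x) + 1 from y onto x; hence ℓ(c) = ℓ(x) + g when ℓ(x) < ℓ(y). In a run, unequal
-- consecutive gaps would pin a midpoint's length below ℓ* + both gaps, and then five
-- reflections extend its palindrome anyway; so all gaps equal d = m₂ − m₁. Adding the
-- non-midpoints m₁ − d and m_h + d at the ends, the first argument applied to m_j between
-- m₁ − d and m_{2j} (or m_{2j−h−1} and m_h + d) gives the formula.

module Submission where

open import Defs
open import Data.Nat using (ℕ; zero; suc; _+_; _*_; _∸_; _≤_; _<_; z≤n; s≤s; _≤?_)
open import Data.Nat.Properties
open import Data.Nat.Tactic.RingSolver using (solve)
open import Data.List using (List; length; _∷_; [])
open import Data.Product using (Σ; _×_; _,_; proj₁; proj₂)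
open import Data.Empty using (⊥; ⊥-elim)
open import Relation.Nullary using (¬_; Dec; yes; no)
open import Relation.Nullary.Decidable using (_×-dec_)
open import Relation.Binary.Definitions using (tri<; tri≈; tri>)
open import Relation.Binary.PropositionalEquality

-- Linear arithmetic: add the hypotheses up to A ≤ B; what remains, l + B ≡ r + A, is a semiring identity.
≤-by-sum : ∀ {l r A B : ℕ} → A ≤ B → l + B ≡ r + A → l ≤ r
≤-by-sum {l} {r} {A} {B} A≤B e = +-cancelʳ-≤ B l r (subst (_≤ r + B) (sym e) (+-monoʳ-≤ r A≤B))

≡-by-sum : ∀ {l r A B : ℕ} → A ≡ B → l + B ≡ r + A → l ≡ r
≡-by-sum {l} {r} {A} {B} A≡B e = +-cancelʳ-≡ B l r (trans e (cong (r +_) A≡B))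

variable
  a b c p q x y g k r r′ C : ℕ

module Palindromes {A : Set} (T : List A) where

  Matching : ℕ → ℕ → Set
  Matching a b = InRange T a × InRange T b × at T a ≡ at T b

  Matching-sym : Matching a b → Matching b a
  Matching-sym (ra , rb , e) = rb , ra , sym e

  Matching-trans : Matching a b → Matching b c → Matching a c
  Matching-trans (ra , _ , e) (_ , rc , e′) = ra , rc , trans e e′

  ¬InRange-0 : ¬ InRange T 0
  ¬InRange-0 (() , _)

  -- The even palindrome of radius r around c + ½, without subtraction:
  -- a and b are mirror images iff a + b = 2c + 1, and both lie within distance r.
  Mirrored : ℕ → ℕ → Set
  Mirrored c r = ∀ a b → a + b ≡ suc (c + c) → suc c ≤ a + r → suc c ≤ b + r → Matching a b

  Mirrored-zero : ∀ c → Mirrored c 0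
  Mirrored-zero c a b a+b a≥ b≥ =
    ⊥-elim (1+n≰n {suc (c + c)} (≤-by-sum (+-mono-≤ (+-mono-≤ a≥ b≥) (≤-reflexive a+b)) (solve (a ∷ b ∷ c ∷ []))))

  Mirrored-mono : r′ ≤ r → Mirrored c r → Mirrored c r′
  Mirrored-mono r′≤r P a b a+b a≥ b≥ =
    P a b a+b (≤-trans a≥ (+-monoʳ-≤ a r′≤r)) (≤-trans b≥ (+-monoʳ-≤ b r′≤r))

  Mirrored-by-lower-half :
    (∀ a b → a + b ≡ suc (c + c) → suc c ≤ a + r → a ≤ c → Matching a b) → Mirrored c r
  Mirrored-by-lower-half {c} H a b a+b a≥ b≥ with a ≤? c
  ... | yes a≤c = H a b a+b a≥ a≤c
  ... | no a≰c = Matching-sym (H b a (trans (+-comm b a) a+b) b≥ b≤c)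
    where
    b≤c : b ≤ c
    b≤c = ≤-by-sum (+-mono-≤ (≰⇒> a≰c) (≤-reflexive a+b)) (solve (a ∷ b ∷ c ∷ []))

  Mirrored⇒radius≤center : Mirrored c r → r ≤ c
  Mirrored⇒radius≤center {c} {r} P with r ≤? c
  ... | yes r≤c = r≤c
  ... | no r≰c =
    ⊥-elim (¬InRange-0 (proj₁ (P 0 (suc (c + c)) refl (≰⇒> r≰c) (s≤s (≤-trans (m≤m+n c c) (m≤m+n _ r))))))

  Mirrored⇒center-inRange : Mirrored c (suc r) → InRange T c
  Mirrored⇒center-inRange {c} {r} P =
    proj₁ (P c (suc c) (+-suc c c) (≤-by-sum (z≤n {r}) (solve (c ∷ r ∷ []))) (m≤m+n (suc c) (suc r)))

  PalAt⇒Mirrored : PalAt T c r → Mirrored c r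
  PalAt⇒Mirrored {c} {r} P = Mirrored-by-lower-half lower
    where
    lower : ∀ a b → a + b ≡ suc (c + c) → suc c ≤ a + r → a ≤ c → Matching a b
    lower a b a+b a≥ a≤c with suc c ∸ a | m∸n+n≡m (m≤n⇒m≤1+n a≤c)
    ... | i | i+a = subst₂ Matching a≡ b≡ (P i 1≤i i≤r)
      where
      1≤i : 1 ≤ i
      1≤i = ≤-by-sum (+-mono-≤ (≤-reflexive (sym i+a)) a≤c) (solve (i ∷ a ∷ c ∷ []))
      i≤r : i ≤ r
      i≤r = ≤-by-sum (+-mono-≤ (≤-reflexive i+a) a≥) (solve (i ∷ a ∷ c ∷ r ∷ []))
      a≡ : suc c ∸ i ≡ a
      a≡ = trans (cong (_∸ i) (sym i+a)) (m+n∸m≡n i a)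
      b≡ : c + i ≡ b
      b≡ = ≡-by-sum (cong₂ _+_ i+a (sym a+b)) (solve (i ∷ a ∷ b ∷ c ∷ []))

  Mirrored⇒PalAt : Mirrored c r → PalAt T c r
  Mirrored⇒PalAt {c} {r} P i 1≤i i≤r
    with suc c ∸ i | m∸n+n≡m (≤-trans i≤r (≤-trans (Mirrored⇒radius≤center P) (n≤1+n c)))
  ... | a | a+i = P a (c + i) (≡-by-sum a+i (solve (a ∷ i ∷ c ∷ [])))
                      (≤-by-sum (+-mono-≤ (≤-reflexive (sym a+i)) i≤r) (solve (a ∷ i ∷ c ∷ r ∷ [])))
                      (≤-by-sum (+-mono-≤ 1≤i (z≤n {r})) (solve (c ∷ i ∷ r ∷ [])))

  Mirrored-extend : Mirrored c C → a + C ≡ c → Matching a (suc (c + C)) → Mirrored c (suc C)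
  Mirrored-extend {c} {C} {a₀} P a₀+C M = Mirrored-by-lower-half outer
    where
    outer : ∀ a b → a + b ≡ suc (c + c) → suc c ≤ a + suc C → a ≤ c → Matching a b
    outer a b a+b a≥ a≤c with suc c ≤? a + C
    ... | yes a>c-C = P a b a+b a>c-C
                        (≤-by-sum (+-mono-≤ (+-mono-≤ a≤c (≤-reflexive (sym a+b))) (z≤n {C}))
                                  (solve (a ∷ b ∷ c ∷ C ∷ [])))
    ... | no a≯c-C = subst₂ Matching (sym a≡a₀) (sym b≡) M
      where
      a+C : a + C ≡ c
      a+C = ≤-antisym (≤-pred (≰⇒> a≯c-C)) (≤-by-sum a≥ (solve (a ∷ c ∷ C ∷ [])))
      a≡a₀ : a ≡ a₀
      a≡a₀ = +-cancelʳ-≡ C a a₀ (trans a+C (sym a₀+C))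
      b≡ : b ≡ suc (c + C)
      b≡ = ≡-by-sum (cong₂ _+_ a+b (sym a+C)) (solve (a ∷ b ∷ c ∷ C ∷ []))

  -- Reflecting a pair mirrored about q through c gives a pair mirrored about p = 2c − q.
  Mirrored-reflect : Mirrored c C → Mirrored p r → p + q ≡ c + c →
                     c + r ≤ p + C → p + r ≤ c + C → Mirrored q r
  Mirrored-reflect {c} {C} {p} {r} {q} Pc Pp p+q c+r≤ p+r≤ a b a+b a≥ b≥
    with reflect a b a+b a≥ b≥ | reflect b a (trans (+-comm b a) a+b) b≥ a≥
    where
    reflect : ∀ a b → a + b ≡ suc (q + q) → suc q ≤ a + r → suc q ≤ b + r →
              Σ ℕ λ a′ → a′ + a ≡ suc (c + c) × Matching a a′ × suc p ≤ a′ + r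
    reflect a b a+b a≥ b≥
      with suc (c + c) ∸ a
         | m∸n+n≡m {suc (c + c)} {a} (≤-by-sum (+-mono-≤ (≤-reflexive a+b) (+-mono-≤ b≥ (+-mono-≤ (≤-reflexive p+q)
                     (+-mono-≤ c+r≤ (+-mono-≤ (Mirrored⇒radius≤center Pc) (z≤n {1}))))))
                     (solve (a ∷ b ∷ c ∷ C ∷ p ∷ q ∷ r ∷ [])))
    ... | a′ | a′+a = a′ , a′+a , Pc a a′ (trans (+-comm a a′) a′+a)
                        (≤-by-sum (+-mono-≤ a≥ (+-mono-≤ p+r≤ (≤-reflexive (sym p+q))))
                                  (solve (a ∷ c ∷ C ∷ p ∷ q ∷ r ∷ [])))
                        (≤-by-sum (+-mono-≤ (≤-reflexive (sym a′+a)) (+-mono-≤ (≤-reflexive a+b)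
                                    (+-mono-≤ b≥ (+-mono-≤ (≤-reflexive p+q) c+r≤))))
                                  (solve (a ∷ b ∷ a′ ∷ c ∷ C ∷ p ∷ q ∷ r ∷ [])))
                      , ≤-by-sum (+-mono-≤ (≤-reflexive (sym a′+a)) (+-mono-≤ (≤-reflexive a+b)
                                   (+-mono-≤ b≥ (≤-reflexive p+q))))
                                 (solve (a ∷ b ∷ a′ ∷ c ∷ p ∷ q ∷ r ∷ []))
  ... | a′ , a′+a , Maa′ , a′≥ | b′ , b′+b , Mbb′ , b′≥ =
    Matching-trans Maa′ (Matching-trans (Matching-sym (Pp b′ a′ b′+a′ b′≥ a′≥)) (Matching-sym Mbb′))
    where
    b′+a′ : b′ + a′ ≡ suc (p + p)
    b′+a′ = ≡-by-sum (cong₂ _+_ a′+a (cong₂ _+_ b′+b (cong₂ _+_ (sym a+b) (cong₂ _+_ (sym p+q) (sym p+q)))))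
                     (solve (a ∷ b ∷ a′ ∷ b′ ∷ c ∷ p ∷ q ∷ []))

  -- The reflections through x, c and y compose to the reflection through c (as x + y = 2c),
  -- and carry c − (k + g) to c + (k + g) + 1 within the three given radii.
  Mirrored-extend-by-neighbours : Mirrored c (k + g) → Mirrored x (suc k) → Mirrored y (suc k) →
                                  x + g ≡ c → c + g ≡ y → 1 ≤ g → Mirrored c (suc k + g)
  Mirrored-extend-by-neighbours {c} {k} {g} {x} {y} Pc Px Py x+g c+g 1≤g
    with x ∸ k | m∸n+n≡m {x} {k} (≤-trans (n≤1+n k) (Mirrored⇒radius≤center Px))
       | y ∸ k | m∸n+n≡m {y} {k} (≤-trans (n≤1+n k) (Mirrored⇒radius≤center Py))
  ... | a₀ | a₀+k | u | u+k =
    Mirrored-extend Pc a₀+k+g (Matching-trans left (Matching-trans middle right))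
    where
    a₀+k+g : a₀ + (k + g) ≡ c
    a₀+k+g = trans (sym (+-assoc a₀ k g)) (trans (cong (_+ g) a₀+k) x+g)
    left : Matching a₀ (x + suc k)
    left = Px a₀ (x + suc k)
             (≡-by-sum a₀+k (solve (a₀ ∷ k ∷ x ∷ [])))
             (≤-by-sum (≤-reflexive (sym a₀+k)) (solve (a₀ ∷ k ∷ x ∷ [])))
             (≤-by-sum (z≤n {suc (k + k)}) (solve (k ∷ x ∷ [])))
    middle : Matching (x + suc k) u
    middle = Pc (x + suc k) u
               (≡-by-sum (cong₂ _+_ u+k (cong₂ _+_ x+g (sym c+g))) (solve (u ∷ k ∷ x ∷ y ∷ c ∷ g ∷ [])))
               (≤-by-sum (+-mono-≤ (≤-reflexive (sym x+g)) (z≤n {k + k})) (solve (x ∷ k ∷ c ∷ g ∷ [])))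
               (≤-by-sum (+-mono-≤ (≤-reflexive (sym u+k)) (+-mono-≤ (≤-reflexive c+g) (+-mono-≤ 1≤g (z≤n {g}))))
                         (solve (u ∷ k ∷ y ∷ c ∷ g ∷ [])))
    right : Matching u (suc (c + (k + g)))
    right = Py u (suc (c + (k + g)))
              (≡-by-sum (cong₂ _+_ u+k c+g) (solve (u ∷ k ∷ y ∷ c ∷ g ∷ [])))
              (≤-by-sum (≤-reflexive (sym u+k)) (solve (u ∷ k ∷ y ∷ [])))
              (≤-by-sum (+-mono-≤ (≤-reflexive (sym c+g)) (z≤n {suc (k + k)})) (solve (y ∷ c ∷ g ∷ k ∷ [])))

  Mirrored-grow : ∀ k → Mirrored c C → g ≤ C → Mirrored x k → Mirrored y k →
                  x + g ≡ c → c + g ≡ y → 1 ≤ g → Mirrored c (k + g)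
  Mirrored-grow zero    Pc g≤C Px Py x+g c+g 1≤g = Mirrored-mono g≤C Pc
  Mirrored-grow (suc k) Pc g≤C Px Py x+g c+g 1≤g =
    Mirrored-extend-by-neighbours
      (Mirrored-grow k Pc g≤C (Mirrored-mono (n≤1+n k) Px) (Mirrored-mono (n≤1+n k) Py) x+g c+g 1≤g)
      Px Py x+g c+g 1≤g

  -- With e = y − C, the reflections through x, z, y, x, z carry e to y + C + 1; together they
  -- compose to the reflection through y, since x then z and z then y are translations.
  Mirrored-extend-flanked : ∀ {ℓ z g₁ g₂} → Mirrored x ℓ → Mirrored y C → Mirrored z ℓ →
                            x + g₁ ≡ y → y + g₂ ≡ z → 1 ≤ g₂ → 2 * g₁ ≤ ℓ → 2 * g₂ ≤ ℓ →
                            ℓ ≤ C → C < ℓ + g₁ → C < ℓ + g₂ → Mirrored y (suc C)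
  Mirrored-extend-flanked {x} {y} {C} {ℓ} {z} {g₁} {g₂} Px Py Pz x+g₁ y+g₂ 1≤g₂ g₁≤ g₂≤ ℓ≤C C<₁ C<₂
    with y ∸ C | m∸n+n≡m {y} {C} (Mirrored⇒radius≤center Py)
       | C ∸ (g₁ + g₂) | m∸n+n≡m {C} {g₁ + g₂} g₁+g₂≤C
    where
    g₁+g₂≤C : g₁ + g₂ ≤ C
    g₁+g₂≤C = *-cancelˡ-≤ 2 (≤-by-sum (+-mono-≤ g₁≤ (+-mono-≤ g₂≤ (+-mono-≤ ℓ≤C ℓ≤C)))
                                      (solve (g₁ ∷ g₂ ∷ ℓ ∷ C ∷ [])))
  ... | e | e+C | k | k+g =
    Mirrored-extend Py e+C (Matching-trans via-x (Matching-trans via-z (Matching-trans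
      (Matching-sym via-y) (Matching-trans (Matching-sym via-x′) via-z′))))
    where
    via-x : Matching e (e + 2 * g₂ + 2 * k + 1)
    via-x = Px e (e + 2 * g₂ + 2 * k + 1)
      (≡-by-sum (cong₂ _+_ (sym x+g₁) (cong₂ _+_ (sym x+g₁) (cong₂ _+_ e+C (cong₂ _+_ e+C (cong₂ _+_ k+g k+g)))))
                (solve (e ∷ C ∷ k ∷ g₁ ∷ g₂ ∷ x ∷ y ∷ [])))
      (≤-by-sum (+-mono-≤ (≤-reflexive x+g₁) (+-mono-≤ (≤-reflexive (sym e+C)) C<₁))
                (solve (e ∷ C ∷ g₁ ∷ ℓ ∷ x ∷ y ∷ [])))
      (≤-by-sum (+-mono-≤ (≤-reflexive x+g₁) (+-mono-≤ (≤-reflexive (sym e+C)) (+-mono-≤ (≤-reflexive (sym k+g))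
                  (+-mono-≤ (z≤n {g₂}) (+-mono-≤ (z≤n {k}) (z≤n {ℓ}))))))
                (solve (e ∷ C ∷ k ∷ g₁ ∷ g₂ ∷ ℓ ∷ x ∷ y ∷ [])))
    via-z : Matching (e + 2 * g₂ + 2 * k + 1) (e + 2 * g₁ + 2 * g₂)
    via-z = Pz (e + 2 * g₂ + 2 * k + 1) (e + 2 * g₁ + 2 * g₂)
      (≡-by-sum (cong₂ _+_ y+g₂ (cong₂ _+_ y+g₂ (cong₂ _+_ e+C (cong₂ _+_ e+C (cong₂ _+_ k+g k+g)))))
                (solve (e ∷ C ∷ k ∷ g₁ ∷ g₂ ∷ y ∷ z ∷ [])))
      (≤-by-sum (+-mono-≤ (≤-reflexive (sym y+g₂)) (+-mono-≤ (≤-reflexive (sym e+C)) (+-mono-≤ (≤-reflexive (sym k+g))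
                  (+-mono-≤ g₁≤ (+-mono-≤ (z≤n {k}) (z≤n {g₁}))))))
                (solve (e ∷ C ∷ k ∷ g₁ ∷ g₂ ∷ ℓ ∷ y ∷ z ∷ [])))
      (≤-by-sum (+-mono-≤ (≤-reflexive (sym y+g₂)) (+-mono-≤ (≤-reflexive (sym e+C)) (+-mono-≤ C<₂ (z≤n {2 * g₁}))))
                (solve (e ∷ C ∷ g₁ ∷ g₂ ∷ ℓ ∷ y ∷ z ∷ [])))
    via-y : Matching (e + 2 * k + 1) (e + 2 * g₁ + 2 * g₂)
    via-y = Py (e + 2 * k + 1) (e + 2 * g₁ + 2 * g₂)
      (≡-by-sum (cong₂ _+_ e+C (cong₂ _+_ e+C (cong₂ _+_ k+g k+g))) (solve (e ∷ C ∷ k ∷ g₁ ∷ g₂ ∷ y ∷ [])))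
      (≤-by-sum (+-mono-≤ (≤-reflexive (sym e+C)) (z≤n {2 * k})) (solve (e ∷ C ∷ k ∷ y ∷ [])))
      (≤-by-sum (+-mono-≤ (≤-reflexive (sym e+C)) (+-mono-≤ 1≤g₂ (+-mono-≤ (z≤n {2 * g₁}) (z≤n {g₂}))))
                (solve (e ∷ C ∷ g₁ ∷ g₂ ∷ y ∷ [])))
    via-x′ : Matching (e + 2 * g₂) (e + 2 * k + 1)
    via-x′ = Px (e + 2 * g₂) (e + 2 * k + 1)
      (≡-by-sum (cong₂ _+_ (sym x+g₁) (cong₂ _+_ (sym x+g₁) (cong₂ _+_ e+C (cong₂ _+_ e+C (cong₂ _+_ k+g k+g)))))
                (solve (e ∷ C ∷ k ∷ g₁ ∷ g₂ ∷ x ∷ y ∷ [])))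
      (≤-by-sum (+-mono-≤ (≤-reflexive x+g₁) (+-mono-≤ (≤-reflexive (sym e+C)) (+-mono-≤ C<₂
                  (+-mono-≤ (z≤n {g₂}) (z≤n {g₁})))))
                (solve (e ∷ C ∷ g₁ ∷ g₂ ∷ ℓ ∷ x ∷ y ∷ [])))
      (≤-by-sum (+-mono-≤ (≤-reflexive x+g₁) (+-mono-≤ (≤-reflexive (sym e+C)) (+-mono-≤ (≤-reflexive (sym k+g))
                  (+-mono-≤ g₂≤ (+-mono-≤ (z≤n {k}) (z≤n {g₂}))))))
                (solve (e ∷ C ∷ k ∷ g₁ ∷ g₂ ∷ ℓ ∷ x ∷ y ∷ [])))
    via-z′ : Matching (e + 2 * g₂) (suc (y + C))
    via-z′ = Pz (e + 2 * g₂) (suc (y + C))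
      (≡-by-sum (cong₂ _+_ y+g₂ (cong₂ _+_ y+g₂ e+C)) (solve (e ∷ C ∷ g₂ ∷ y ∷ z ∷ [])))
      (≤-by-sum (+-mono-≤ (≤-reflexive (sym y+g₂)) (+-mono-≤ (≤-reflexive (sym e+C)) C<₂))
                (solve (e ∷ C ∷ g₂ ∷ ℓ ∷ y ∷ z ∷ [])))
      (≤-by-sum (+-mono-≤ (≤-reflexive (sym y+g₂)) (+-mono-≤ g₂≤ (+-mono-≤ (z≤n {C}) (z≤n {g₂}))))
                (solve (C ∷ g₂ ∷ ℓ ∷ y ∷ z ∷ [])))

  module Lengths (L : ℕ → ℕ) (isPalLen : IsPalLen T L) where

    inRange? : ∀ c → Dec (InRange T c)
    inRange? c = (1 ≤? c) ×-dec (c ≤? length T)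

    -- Out of range L c = 0 and Mirrored c 0 is vacuous, so these two hold at every c.
    mirrored : ∀ c → Mirrored c (L c)
    mirrored c with inRange? c
    ... | yes c∈ = PalAt⇒Mirrored (proj₁ (proj₁ isPalLen c c∈))
    ... | no c∉ = subst (Mirrored c) (sym (proj₂ isPalLen c c∉)) (Mirrored-zero c)

    maximal : Mirrored c r → r ≤ L c
    maximal {r = zero}  _ = z≤n
    maximal {c} {suc r} P = proj₂ (proj₁ isPalLen c (Mirrored⇒center-inRange P)) (suc r) (Mirrored⇒PalAt P)

    positive⇒inRange : 1 ≤ L c → InRange T c
    positive⇒inRange {c} 1≤L = Mirrored⇒center-inRange (Mirrored-mono 1≤L (mirrored c))

    length-reflect : p + q ≡ c + c → c + r ≤ p + L c → p + r ≤ c + L c → r ≤ L p → r ≤ L q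
    length-reflect {p} {c = c} p+q c+r≤ p+r≤ r≤L =
      maximal (Mirrored-reflect (mirrored c) (Mirrored-mono r≤L (mirrored p)) p+q c+r≤ p+r≤)

    length-grow : x + g ≡ c → c + g ≡ y → 1 ≤ g → g ≤ L c → k ≤ L x → k ≤ L y → k + g ≤ L c
    length-grow {x} {c = c} {y} {k} x+g c+g 1≤g g≤L k≤Lx k≤Ly =
      maximal (Mirrored-grow k (mirrored c) g≤L (Mirrored-mono k≤Lx (mirrored x)) (Mirrored-mono k≤Ly (mirrored y))
                             x+g c+g 1≤g)

    length-between-left : x + g ≡ c → c + g ≡ y → 1 ≤ g → g ≤ L c → L x < L y → L c ≡ L x + g
    length-between-left {x} {g} {c} {y} x+g c+g 1≤g g≤L Lx<Ly =
      ≤-antisym (≮⇒≥ too-long) (length-grow x+g c+g 1≤g g≤L ≤-refl (<⇒≤ Lx<Ly))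
      where
      covers : ∀ {a b} → a + g < b → c + suc a ≤ y + b × y + suc a ≤ c + b
      covers {a} {b} a+g<b =
        ≤-by-sum (+-mono-≤ a+g<b (+-mono-≤ (≤-reflexive c+g) (z≤n {g + g}))) (solve (a ∷ b ∷ g ∷ c ∷ y ∷ [])) ,
        ≤-by-sum (+-mono-≤ a+g<b (≤-reflexive (sym c+g))) (solve (a ∷ b ∷ g ∷ c ∷ y ∷ []))
      too-long : ¬ L x + g < L c
      too-long Lc> = 1+n≰n (length-reflect {p = y} {q = x} {c = c}
        (≡-by-sum (cong₂ _+_ x+g (sym c+g)) (solve (x ∷ g ∷ c ∷ y ∷ [])))
        (proj₁ (covers Lc>)) (proj₂ (covers Lc>)) Lx<Ly)

    length-between-right : x + g ≡ c → c + g ≡ y → 1 ≤ g → g ≤ L c → L y < L x → L c ≡ L y + g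
    length-between-right {x} {g} {c} {y} x+g c+g 1≤g g≤L Ly<Lx =
      ≤-antisym (≮⇒≥ too-long) (length-grow x+g c+g 1≤g g≤L (<⇒≤ Ly<Lx) ≤-refl)
      where
      covers : ∀ {a b} → a + g < b → c + suc a ≤ x + b × x + suc a ≤ c + b
      covers {a} {b} a+g<b =
        ≤-by-sum (+-mono-≤ a+g<b (≤-reflexive (sym x+g))) (solve (a ∷ b ∷ g ∷ c ∷ x ∷ [])) ,
        ≤-by-sum (+-mono-≤ a+g<b (+-mono-≤ (≤-reflexive x+g) (z≤n {g + g}))) (solve (a ∷ b ∷ g ∷ c ∷ x ∷ []))
      too-long : ¬ L y + g < L c
      too-long Lc> = 1+n≰n (length-reflect {p = x} {q = y} {c = c}
        (≡-by-sum (cong₂ _+_ x+g (sym c+g)) (solve (x ∷ g ∷ c ∷ y ∷ [])))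
        (proj₁ (covers Lc>)) (proj₂ (covers Lc>)) Ly<Lx)

    flanked-not-short : ∀ {ℓ z g₁ g₂} → x + g₁ ≡ y → y + g₂ ≡ z → 1 ≤ g₂ → 2 * g₁ ≤ ℓ → 2 * g₂ ≤ ℓ →
                        ℓ ≤ L x → ℓ ≤ L y → ℓ ≤ L z → L y < ℓ + g₁ → L y < ℓ + g₂ → ⊥
    flanked-not-short {x} {y} {z = z} x+g₁ y+g₂ 1≤g₂ g₁≤ g₂≤ ℓ≤Lx ℓ≤Ly ℓ≤Lz short₁ short₂ =
      1+n≰n (maximal (Mirrored-extend-flanked (Mirrored-mono ℓ≤Lx (mirrored x)) (mirrored y)
                        (Mirrored-mono ℓ≤Lz (mirrored z)) x+g₁ y+g₂ 1≤g₂ g₁≤ g₂≤ ℓ≤Ly short₁ short₂))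

    -- If g₂ < g₁, the non-midpoint w = y − g₂ gives L y = L w + g₂ < ℓ + g₂ (symmetrically if g₁ < g₂).
    gaps-equal : ∀ {ℓ z g₁ g₂} → x + g₁ ≡ y → y + g₂ ≡ z → 1 ≤ g₁ → 1 ≤ g₂ → 2 * g₁ ≤ ℓ → 2 * g₂ ≤ ℓ →
                 ℓ ≤ L x → ℓ ≤ L y → ℓ ≤ L z →
                 (∀ w → x < w → w < y → L w < ℓ) → (∀ w → y < w → w < z → L w < ℓ) → g₁ ≡ g₂
    gaps-equal {x} {y} {ℓ} {z} {g₁} {g₂} x+g₁ y+g₂ 1≤g₁ 1≤g₂ g₁≤ g₂≤ ℓ≤Lx ℓ≤Ly ℓ≤Lz left right
      with <-cmp g₁ g₂
    ... | tri≈ _ g₁≡g₂ _ = g₁≡g₂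
    ... | tri< g₁<g₂ _ _ =
      ⊥-elim (flanked-not-short x+g₁ y+g₂ 1≤g₂ g₁≤ g₂≤ ℓ≤Lx ℓ≤Ly ℓ≤Lz
                short (<-trans short (+-monoʳ-< ℓ g₁<g₂)))
      where
      y<w : y < y + g₁
      y<w = ≤-by-sum 1≤g₁ (solve (y ∷ g₁ ∷ []))
      w<z : y + g₁ < z
      w<z = ≤-by-sum (+-mono-≤ g₁<g₂ (≤-reflexive y+g₂)) (solve (y ∷ g₁ ∷ g₂ ∷ z ∷ []))
      Lw<ℓ : L (y + g₁) < ℓ
      Lw<ℓ = right (y + g₁) y<w w<z
      short : L y < ℓ + g₁
      short = subst (_< ℓ + g₁)
                (sym (length-between-right x+g₁ refl 1≤g₁ (≤-trans (m≤m+n g₁ (g₁ + 0)) (≤-trans g₁≤ ℓ≤Ly))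
                                           (<-≤-trans Lw<ℓ ℓ≤Lx)))
                (+-monoˡ-< g₁ Lw<ℓ)
    ... | tri> _ _ g₂<g₁
      with y ∸ g₂ | m∸n+n≡m {y} {g₂} (≤-trans (<⇒≤ g₂<g₁) (≤-trans (m≤n+m g₁ x) (≤-reflexive x+g₁)))
    ... | w | w+g₂ =
      ⊥-elim (flanked-not-short x+g₁ y+g₂ 1≤g₂ g₁≤ g₂≤ ℓ≤Lx ℓ≤Ly ℓ≤Lz
                (<-trans short (+-monoʳ-< ℓ g₂<g₁)) short)
      where
      x<w : x < w
      x<w = ≤-by-sum (+-mono-≤ g₂<g₁ (+-mono-≤ (≤-reflexive x+g₁) (≤-reflexive (sym w+g₂))))
                     (solve (x ∷ w ∷ y ∷ g₁ ∷ g₂ ∷ []))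
      w<y : w < y
      w<y = ≤-by-sum (+-mono-≤ 1≤g₂ (≤-reflexive w+g₂)) (solve (w ∷ y ∷ g₂ ∷ []))
      Lw<ℓ : L w < ℓ
      Lw<ℓ = left w x<w w<y
      short : L y < ℓ + g₂
      short = subst (_< ℓ + g₂)
                (sym (length-between-left w+g₂ y+g₂ 1≤g₂ (≤-trans (m≤m+n g₂ (g₂ + 0)) (≤-trans g₂≤ ℓ≤Ly))
                                          (<-≤-trans Lw<ℓ ℓ≤Lz)))
                (+-monoˡ-< g₂ Lw<ℓ)

    module Run {ℓ h : ℕ} {M : ℕ → ℕ} (run : IsMaximalRun T L ℓ h M) where

      increasing : ∀ j → 1 ≤ j → j < h → M j < M (suc j)
      increasing = proj₁ (proj₂ run)

      ℓ≤L-M : ∀ {j} → 1 ≤ j → j ≤ h → ℓ ≤ L (M j)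
      ℓ≤L-M {j} 1≤j j≤h = proj₂ (proj₁ (proj₂ (proj₂ run)) j 1≤j j≤h)

      gap : ℕ → ℕ
      gap j = M (suc j) ∸ M j

      2*gap≤ℓ : ∀ j → 1 ≤ j → j < h → 2 * gap j ≤ ℓ
      2*gap≤ℓ = proj₁ (proj₂ (proj₂ (proj₂ (proj₂ run))))

      d : ℕ
      d = gap 1

      2≤h : 2 ≤ h
      2≤h = ≤-trans (n≤1+n 2) (proj₁ run)

      1≤d : 1 ≤ d
      1≤d = m<n⇒0<n∸m (increasing 1 ≤-refl 2≤h)

      d≤ℓ : d ≤ ℓ
      d≤ℓ = ≤-trans (m≤m+n d (d + 0)) (2*gap≤ℓ 1 ≤-refl 2≤h)

      L<ℓ-inside-gap : ∀ j → 1 ≤ j → j < h → ∀ w → M j < w → w < M (suc j) → L w < ℓ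
      L<ℓ-inside-gap j 1≤j j<h w Mj<w w<Mj+1 = ≰⇒> λ ℓ≤Lw →
        proj₁ (proj₂ (proj₂ (proj₂ run))) j 1≤j j<h w Mj<w w<Mj+1
          (positive⇒inRange (≤-trans (≤-trans 1≤d d≤ℓ) ℓ≤Lw) , ℓ≤Lw)

      M+gap : ∀ j → 1 ≤ j → j < h → M j + gap j ≡ M (suc j)
      M+gap j 1≤j j<h = m+[n∸m]≡n (<⇒≤ (increasing j 1≤j j<h))

      gap-constant : ∀ n → suc n < h → gap (suc n) ≡ d
      gap-constant zero    _  = refl
      gap-constant (suc n) lt = trans (sym gap≡gap) (gap-constant n n+1<h)
        where
        n+1<h : suc n < h
        n+1<h = ≤-trans (n≤1+n _) lt
        gap≡gap : gap (suc n) ≡ gap (suc (suc n))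
        gap≡gap = gaps-equal (M+gap (suc n) (s≤s z≤n) n+1<h) (M+gap (suc (suc n)) (s≤s z≤n) lt)
                    (m<n⇒0<n∸m (increasing (suc n) (s≤s z≤n) n+1<h)) (m<n⇒0<n∸m (increasing (suc (suc n)) (s≤s z≤n) lt))
                    (2*gap≤ℓ (suc n) (s≤s z≤n) n+1<h) (2*gap≤ℓ (suc (suc n)) (s≤s z≤n) lt)
                    (ℓ≤L-M (s≤s z≤n) (<⇒≤ n+1<h)) (ℓ≤L-M (s≤s z≤n) (<⇒≤ lt)) (ℓ≤L-M (s≤s z≤n) lt)
                    (L<ℓ-inside-gap (suc n) (s≤s z≤n) n+1<h) (L<ℓ-inside-gap (suc (suc n)) (s≤s z≤n) lt)

      M-arithmetic : ∀ n → suc n ≤ h → M (suc n) ≡ M 1 + n * d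
      M-arithmetic zero    _  = sym (+-identityʳ (M 1))
      M-arithmetic (suc n) le = begin
        M (suc (suc n))            ≡⟨ sym (M+gap (suc n) (s≤s z≤n) le) ⟩
        M (suc n) + gap (suc n)    ≡⟨ cong₂ _+_ (M-arithmetic n (≤-trans (n≤1+n _) le)) (gap-constant n le) ⟩
        M 1 + n * d + d            ≡⟨ +-assoc (M 1) (n * d) d ⟩
        M 1 + (n * d + d)          ≡⟨ cong (M 1 +_) (+-comm (n * d) d) ⟩
        M 1 + suc n * d            ∎
        where open ≡-Reasoning

      -- The run extended by one step on each side: point 0 and point (h + 1) are the two
      -- midpoints of the maximality condition, and point j = M j for 1 ≤ j ≤ h.
      point : ℕ → ℕ
      point i = (M 1 ∸ d) + i * d

      point-+ : ∀ i k → point i + k * d ≡ point (i + k)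
      point-+ i k = trans (+-assoc (M 1 ∸ d) (i * d) (k * d)) (cong ((M 1 ∸ d) +_) (sym (*-distribʳ-+ d i k)))

      point≡M : ∀ {j} → 1 ≤ j → j ≤ h → point j ≡ M j
      point≡M {suc n} _ le = begin
        (M 1 ∸ d) + (d + n * d)    ≡⟨ sym (+-assoc (M 1 ∸ d) d (n * d)) ⟩
        (M 1 ∸ d) + d + n * d      ≡⟨ cong (_+ n * d) (m∸n+n≡m d≤M1) ⟩
        M 1 + n * d                ≡⟨ sym (M-arithmetic n le) ⟩
        M (suc n)                  ∎
        where
        open ≡-Reasoning
        d≤M1 : d ≤ M 1
        d≤M1 = ≤-trans d≤ℓ (≤-trans (ℓ≤L-M ≤-refl (≤-trans (n≤1+n 1) 2≤h))
                                    (Mirrored⇒radius≤center (mirrored (M 1))))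

      ℓ≤L-point : ∀ {j} → 1 ≤ j → j ≤ h → ℓ ≤ L (point j)
      ℓ≤L-point 1≤j j≤h = subst (λ w → ℓ ≤ L w) (sym (point≡M 1≤j j≤h)) (ℓ≤L-M 1≤j j≤h)

      L-point-0<ℓ : L (point 0) < ℓ
      L-point-0<ℓ = subst (λ w → L w < ℓ) (sym (+-identityʳ (M 1 ∸ d)))
                      (proj₁ (proj₂ (proj₂ (proj₂ (proj₂ (proj₂ run))))))

      L-point-h+1<ℓ : L (point (suc h)) < ℓ
      L-point-h+1<ℓ = subst (λ w → L w < ℓ) point-h+1 (proj₂ (proj₂ (proj₂ (proj₂ (proj₂ (proj₂ run))))))
        where
        point-h+1 : M h + d ≡ point (suc h)
        point-h+1 = trans (cong (_+ d) (sym (point≡M (≤-trans (s≤s z≤n) 2≤h) ≤-refl)))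
                          (trans (cong (point h +_) (sym (*-identityˡ d))) (trans (point-+ h 1) (cong point (+-comm h 1))))

      1≤[1+k]*d : ∀ k → 1 ≤ suc k * d
      1≤[1+k]*d k = ≤-trans 1≤d (m≤m+n d (k * d))

      ℓ+k*d≤L-point : ∀ k {p i} → p + k ≡ i → 1 ≤ p → i + k ≤ h → ℓ + k * d ≤ L (point i)
      ℓ+k*d≤L-point zero {p} {i} p+0 1≤p i+0≤h =
        subst (_≤ L (point i)) (sym (+-identityʳ ℓ))
          (ℓ≤L-point (≤-trans 1≤p (≤-trans (m≤m+n p 0) (≤-reflexive p+0))) (≤-trans (m≤m+n i 0) i+0≤h))
      ℓ+k*d≤L-point (suc k) {p} {i} p+k 1≤p i+k≤h =
        length-grow (trans (point-+ p (suc k)) (cong point p+k)) (point-+ i (suc k)) (1≤[1+k]*d k)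
          (≤-trans (+-monoˡ-≤ (k * d) d≤ℓ) inner) (ℓ≤L-point 1≤p p≤h)
          (ℓ≤L-point (≤-trans (s≤s z≤n) (m≤n+m (suc k) i)) i+k≤h)
        where
        inner : ℓ + k * d ≤ L (point i)
        inner = ℓ+k*d≤L-point k (trans (sym (+-suc p k)) p+k) (s≤s z≤n) (≤-trans (+-monoʳ-≤ i (n≤1+n k)) i+k≤h)
        p≤h : p ≤ h
        p≤h = ≤-trans (m≤m+n p (suc k)) (≤-trans (≤-reflexive p+k) (≤-trans (m≤m+n i (suc k)) i+k≤h))

      [1+k]*d≤L-point : ∀ k {p i} → p + suc k ≡ i → i + k ≤ h → suc k * d ≤ L (point i)
      [1+k]*d≤L-point k {p} p+k i+k≤h =
        ≤-trans (+-monoˡ-≤ (k * d) d≤ℓ) (ℓ+k*d≤L-point k (trans (sym (+-suc p k)) p+k) (s≤s z≤n) i+k≤h)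

      length-from-left : ∀ k → suc k + suc k ≤ h → L (point (suc k)) ≡ L (point 0) + suc k * d
      length-from-left k le =
        length-between-left (point-+ 0 (suc k)) (point-+ (suc k) (suc k)) (1≤[1+k]*d k)
          ([1+k]*d≤L-point k {0} refl (≤-trans (+-monoʳ-≤ (suc k) (n≤1+n k)) le))
          (<-≤-trans L-point-0<ℓ (ℓ≤L-point (s≤s z≤n) le))

      length-from-right : ∀ k {p i} → 1 ≤ p → p + suc k ≡ i → i + suc k ≡ suc h →
                          L (point i) ≡ L (point (suc h)) + suc k * d
      length-from-right k {p} {i} 1≤p p+k i+k =
        length-between-right {x = point p} (trans (point-+ p (suc k)) (cong point p+k))
          (trans (point-+ i (suc k)) (cong point i+k)) (1≤[1+k]*d k) ([1+k]*d≤L-point k p+k i+k≤h)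
          (<-≤-trans L-point-h+1<ℓ (ℓ≤L-point 1≤p p≤h))
        where
        i+k≤h : i + k ≤ h
        i+k≤h = ≤-reflexive (suc-injective (trans (sym (+-suc i k)) i+k))
        p≤h : p ≤ h
        p≤h = ≤-trans (m≤m+n p (suc k)) (≤-trans (≤-reflexive p+k) (≤-trans (m≤m+n i k) i+k≤h))

      L-M-first : L (M 1) ≡ L (point 0) + d
      L-M-first = begin
        L (M 1)                   ≡⟨ cong L (sym (point≡M ≤-refl (≤-trans (n≤1+n 1) 2≤h))) ⟩
        L (point 1)               ≡⟨ length-from-left 0 2≤h ⟩
        L (point 0) + (d + 0)     ≡⟨ cong (L (point 0) +_) (+-identityʳ d) ⟩
        L (point 0) + d           ∎
        where open ≡-Reasoning

      L-M-last : L (M h) ≡ L (point (suc h)) + d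
      L-M-last = begin
        L (M h)                       ≡⟨ cong L (sym (point≡M 1≤h ≤-refl)) ⟩
        L (point h)                   ≡⟨ length-from-right 0 (∸-monoˡ-≤ 1 2≤h) (m∸n+n≡m 1≤h) (+-comm h 1) ⟩
        L (point (suc h)) + (d + 0)   ≡⟨ cong (L (point (suc h)) +_) (+-identityʳ d) ⟩
        L (point (suc h)) + d         ∎
        where
        open ≡-Reasoning
        1≤h : 1 ≤ h
        1≤h = ≤-trans (s≤s z≤n) 2≤h

      left-formula : ∀ n → 2 * suc n < h + 1 → L (M (suc n)) ≡ L (M 1) + n * d
      left-formula n lt = begin
        L (M (suc n))                ≡⟨ cong L (sym (point≡M (s≤s z≤n) (≤-trans (m≤m+n (suc n) (suc n)) le))) ⟩
        L (point (suc n))            ≡⟨ length-from-left n le ⟩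
        L (point 0) + (d + n * d)    ≡⟨ sym (+-assoc (L (point 0)) d (n * d)) ⟩
        L (point 0) + d + n * d      ≡⟨ cong (_+ n * d) (sym L-M-first) ⟩
        L (M 1) + n * d              ∎
        where
        open ≡-Reasoning
        le : suc n + suc n ≤ h
        le = ≤-by-sum lt (solve (n ∷ h ∷ []))

      right-formula : ∀ n → suc n ≤ h → h + 1 < 2 * suc n → L (M (suc n)) ≡ L (M h) + (h ∸ suc n) * d
      right-formula n le gt with h ∸ suc n | m+[n∸m]≡n le
      ... | k | j+k with n ∸ suc k
                       | m∸n+n≡m {n} {suc k} (≤-by-sum (+-mono-≤ gt (≤-reflexive j+k)) (solve (n ∷ k ∷ h ∷ [])))
      ... | p | p+k = begin
        L (M (suc n))                      ≡⟨ cong L (sym (point≡M (s≤s z≤n) le)) ⟩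
        L (point (suc n))                  ≡⟨ length-from-right k (s≤s (z≤n {p})) (cong suc p+k) j+1+k ⟩
        L (point (suc h)) + (d + k * d)    ≡⟨ sym (+-assoc (L (point (suc h))) d (k * d)) ⟩
        L (point (suc h)) + d + k * d      ≡⟨ cong (_+ k * d) (sym L-M-last) ⟩
        L (M h) + k * d                    ∎
        where
        open ≡-Reasoning
        j+1+k : suc n + suc k ≡ suc h
        j+1+k = trans (+-suc (suc n) k) (cong suc j+k)

lemma6 : {A : Set} (T : List A) (L : ℕ → ℕ) → IsPalLen T L →
    (ℓ* h : ℕ) (M : ℕ → ℕ) → IsMaximalRun T L ℓ* h M →
    ∀ j → 1 ≤ j → j ≤ h →
    (2 * j < h + 1 → L (M j) ≡ L (M 1) + (j ∸ 1) * (M 2 ∸ M 1)) ×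
    (h + 1 < 2 * j → L (M j) ≡ L (M h) + (h ∸ j) * (M 2 ∸ M 1))
lemma6 T L isPalLen ℓ* h M run (suc n) _ j≤h = left-formula n , right-formula n j≤h
  where open Palindromes.Lengths.Run T L isPalLen run
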